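{- Let $n\ge3$ be an integer. If a spiky function $\lambda:2^{E_n}\to\mathbb N$ is the connectivity function of a matroid $M$ on $E_n$, then $M$ is a rank-$n$ spike with legs $L_1,\dots,L_n$.
   Context: Let $L_i=\{x_i,y_i\}$ ($i=1,\dots,n$) be pairwise disjoint two-element sets (legs) and $E_n=L_1\cup\dots\cup L_n$. A transversal is a set $\{z_1,\dots,z_n\}$ with $z_i\in\{x_i,y_i\}$; $\mathcal T_n$ is the set of transversals. For $X\subseteq E_n$ let $l(X)$ be the number of legs meeting $X$. Define $r_n$ on $2^{E_n}-\mathcal T_n$ by: if $X$ includes no leg and is disjoint from some leg, $r_n(X)=|X|$; if $X$ includes some leg and is disjoint from some other leg, $r_n(X)=l(X)+1$; if $X$ includes some leg and meets all legs, $r_n(X)=n$. Let $\lambda_n(X)=r_n(X)+r_n(E_n-X)-n$ for $X\notin\mathcal T_n$. A function $\lambda:2^{E_n}\to\mathbb N$ is spiky if it is symmetric ($\lambda(X)=\lambda(E_n-X)$), agrees with $\lambda_n$ off $\mathcal T_n$, takes values in $\{n-2,n-1,n\}$ on $\mathcal T_n$, and satisfies $\lambda(X)+\lambda(Y)\ge2n-2$ for transversals $X,Y$ differing in exactly one element. The connectivity function of a matroid $M$ on $E$ with rank function $r$ is $\mu_M(X)=r(X)+r(E-X)-r(E)$. A rank-$n$ spike with legs $L_1,\dots,L_n$ is a matroid on $E_n$ in which, for every $k\in\{1,\dots,n-1\}$, the union of any $k$ legs has rank $k+1$, and $E_n$ has rank $n$. -}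

module Defs where

open import Data.Nat using (ℕ; zero; suc; _+_; _∸_; _≤_)
open import Data.Bool using (Bool; true; false; _∧_; _∨_; not; if_then_else_; _xor_)
open import Data.Product using (_×_; _,_; proj₁; proj₂)
open import Data.Sum using (_⊎_)
open import Data.Vec using (Vec; []; _∷_; map; zipWith; replicate)
open import Data.Vec.Relation.Unary.All using (All)
open import Data.Vec.Relation.Binary.Pointwise.Inductive using (Pointwise)
open import Relation.Binary.PropositionalEquality using (_≡_)
open import Relation.Nullary using (¬_)

-- The ground set E_n = L_1 ∪ … ∪ L_n, L_i = {x_i , y_i}.
-- A subset X ⊆ E_n is encoded as a vector whose i-th entry (a , b)
-- records whether x_i ∈ X (a) and whether y_i ∈ X (b).
SubE : ℕ → Set
SubE n = Vec (Bool × Bool) n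

full : (n : ℕ) → SubE n
full n = replicate n (true , true)

∁ : ∀ {n} → SubE n → SubE n
∁ = map (λ p → not (proj₁ p) , not (proj₂ p))

_∪_ : ∀ {n} → SubE n → SubE n → SubE n
_∪_ = zipWith (λ p q → (proj₁ p ∨ proj₁ q) , (proj₂ p ∨ proj₂ q))

_∩_ : ∀ {n} → SubE n → SubE n → SubE n
_∩_ = zipWith (λ p q → (proj₁ p ∧ proj₁ q) , (proj₂ p ∧ proj₂ q))

_⇒ᵇ_ : Bool → Bool → Bool
a ⇒ᵇ b = not a ∨ b

_⊆_ : ∀ {n} → SubE n → SubE n → Set
X ⊆ Y = Pointwise (λ p q → ((proj₁ p ⇒ᵇ proj₁ q) ∧ (proj₂ p ⇒ᵇ proj₂ q)) ≡ true) X Y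

b2n : Bool → ℕ
b2n true = 1
b2n false = 0

∣_∣ : ∀ {n} → SubE n → ℕ
∣ [] ∣ = 0
∣ (a , b) ∷ X ∣ = b2n a + b2n b + ∣ X ∣

legsMet : ∀ {n} → SubE n → ℕ
legsMet [] = 0
legsMet ((a , b) ∷ X) = b2n (a ∨ b) + legsMet X

includesLeg : ∀ {n} → SubE n → Bool
includesLeg [] = false
includesLeg ((a , b) ∷ X) = (a ∧ b) ∨ includesLeg X

meetsAll : ∀ {n} → SubE n → Bool
meetsAll [] = true
meetsAll ((a , b) ∷ X) = (a ∨ b) ∧ meetsAll X

IsTransversal : ∀ {n} → SubE n → Set
IsTransversal X = All (λ p → (proj₁ p xor proj₂ p) ≡ true) X

-- number of legs on which X and Y differ; for transversals X, Y this is
-- |X - Y| = |Y - X|, the number of elements in which they differ.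
legsDiffering : ∀ {n} → SubE n → SubE n → ℕ
legsDiffering [] [] = 0
legsDiffering ((a , b) ∷ X) ((c , d) ∷ Y) =
  b2n ((a xor c) ∨ (b xor d)) + legsDiffering X Y

-- r_n (only meaningful off transversals; there it is as in the paper)
r : (n : ℕ) → SubE n → ℕ
r n X = if includesLeg X
          then (if meetsAll X then n else suc (legsMet X))
          else ∣ X ∣

-- λ_n(X) = r_n(X) + r_n(E_n - X) - n  (always ≥ 0 off transversals)
λₙ : (n : ℕ) → SubE n → ℕ
λₙ n X = r n X + r n (∁ X) ∸ n

record Spiky (n : ℕ) (λf : SubE n → ℕ) : Set where
  field
    symmetric : ∀ X → λf X ≡ λf (∁ X)
    offT      : ∀ X → ¬ IsTransversal X → λf X ≡ λₙ n X
    onT       : ∀ X → IsTransversal X →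
                  (λf X ≡ n ∸ 2) ⊎ (λf X ≡ n ∸ 1) ⊎ (λf X ≡ n)
    adjacent  : ∀ X Y → IsTransversal X → IsTransversal Y →
                  legsDiffering X Y ≡ 1 → (n + n) ∸ 2 ≤ λf X + λf Y

record Matroid (n : ℕ) : Set where
  field
    rank        : SubE n → ℕ
    rank-bound  : ∀ X → rank X ≤ ∣ X ∣
    rank-mono   : ∀ X Y → X ⊆ Y → rank X ≤ rank Y
    rank-submod : ∀ X Y → rank (X ∪ Y) + rank (X ∩ Y) ≤ rank X + rank Y

conn : ∀ {n} → Matroid n → SubE n → ℕ
conn {n} M X = rank X + rank (∁ X) ∸ rank (full n)
  where open Matroid M

IsLegUnion : ∀ {n} → SubE n → Set
IsLegUnion X = All (λ p → proj₁ p ≡ proj₂ p) X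

IsSpike : ∀ {n} → Matroid n → Set
IsSpike {n} M =
  (∀ X → IsLegUnion X → 1 ≤ legsMet X → legsMet X ≤ n ∸ 1 →
     Matroid.rank M X ≡ suc (legsMet X))
  × Matroid.rank M (full n) ≡ n

module Submission where

-- Only the values of the connectivity function off the transversals are used:
-- there μ_M = λ_n.  A set of legs is coded by a Boolean vector v ("leg i is
-- chosen"); 'legs v' is the union of the chosen legs and 'thin v' keeps the
-- first chosen leg whole but only the element x_i of every other chosen leg.
-- When v chooses k legs, 0 < k < n, the function r_n gives
--   λ_n(legs v) = 2   and   λ_n(thin v) = k + 1.
-- Two general facts about any matroid finish the argument:
--   μ_M(X) + r(E) = r(X) + r(E - X)   and   μ_M(X) ≤ r(X).
-- (1) Lower bound: k + 1 = μ_M(thin v) ≤ r(thin v) ≤ r(legs v).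
-- (2) Total rank: for k = n - 1 the same set gives n ≤ r(E), while
--     n + r(E) = r(thin v) + r(E - thin v) ≤ |E| = 2n gives r(E) ≤ n.
-- (3) Upper bound: r(legs v) + r(E - legs v) = 2 + n, and the complement is
--     the union of the other n - k legs, of rank ≥ n - k + 1 by (1).

open import Defs
open import Data.Nat using (ℕ; zero; suc; _+_; _∸_; _≤_; z≤n; s≤s)
open import Data.Nat.Properties
open import Data.Bool using (Bool; true; false; not; _∧_)
open import Data.Bool.Properties using (∨-zeroʳ; ∨-inverseʳ)
open import Data.Product using (_×_; _,_; proj₁)
open import Data.Vec using (Vec; []; _∷_; map; replicate)
open import Data.Vec.Relation.Unary.All using ([]; _∷_)
open import Data.Vec.Relation.Binary.Pointwise.Inductive using ([]; _∷_)
open import Data.Empty using (⊥-elim)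
open import Relation.Binary.PropositionalEquality
open import Relation.Nullary using (¬_)

count : ∀ {n} → Vec Bool n → ℕ
count []      = 0
count (b ∷ v) = b2n b + count v

negate : ∀ {n} → Vec Bool n → Vec Bool n
negate = map not

count-negate : ∀ {n} (v : Vec Bool n) → count v + count (negate v) ≡ n
count-negate []          = refl
count-negate (true ∷ v)  = cong suc (count-negate v)
count-negate (false ∷ v) = trans (+-suc (count v) _) (cong suc (count-negate v))

negate-involutive : ∀ {n} (v : Vec Bool n) → negate (negate v) ≡ v
negate-involutive []          = refl
negate-involutive (true ∷ v)  = cong (true ∷_) (negate-involutive v)
negate-involutive (false ∷ v) = cong (false ∷_) (negate-involutive v)

complement-nonempty : ∀ {n} (v : Vec Bool n) →
  1 ≤ count v → count v ≤ n ∸ 1 → 1 ≤ count (negate v)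
complement-nonempty {n} v chosen≥1 chosen≤ with count (negate v) | count-negate v
... | suc _ | _     = s≤s z≤n
... | zero  | total = ⊥-elim (no-fixed-pred (count v) chosen≥1
                        (subst (λ m → count v ≤ m ∸ 1)
                               (sym (trans (sym (+-identityʳ (count v))) total)) chosen≤))
  where
  no-fixed-pred : ∀ m → 1 ≤ m → ¬ (m ≤ m ∸ 1)
  no-fixed-pred (suc j) _ = n≮n j

legs : ∀ {n} → Vec Bool n → SubE n
legs = map (λ a → a , a)

xPoints : ∀ {n} → Vec Bool n → SubE n
xPoints = map (λ a → a , false)

thin : ∀ {n} → Vec Bool n → SubE n
thin []          = []
thin (true ∷ v)  = (true , true) ∷ xPoints v
thin (false ∷ v) = (false , false) ∷ thin v

legs-of-union : ∀ {n} (X : SubE n) → IsLegUnion X → X ≡ legs (map proj₁ X)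
legs-of-union []            []         = refl
legs-of-union ((a , .a) ∷ X) (refl ∷ u) = cong ((a , a) ∷_) (legs-of-union X u)

∁-legs : ∀ {n} (v : Vec Bool n) → ∁ (legs v) ≡ legs (negate v)
∁-legs []          = refl
∁-legs (true ∷ v)  = cong ((false , false) ∷_) (∁-legs v)
∁-legs (false ∷ v) = cong ((true , true) ∷_) (∁-legs v)

legsMet-legs : ∀ {n} (v : Vec Bool n) → legsMet (legs v) ≡ count v
legsMet-legs []          = refl
legsMet-legs (true ∷ v)  = cong suc (legsMet-legs v)
legsMet-legs (false ∷ v) = legsMet-legs v

legsMet-xPoints : ∀ {n} (v : Vec Bool n) → legsMet (xPoints v) ≡ count v
legsMet-xPoints []          = refl
legsMet-xPoints (true ∷ v)  = cong suc (legsMet-xPoints v)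
legsMet-xPoints (false ∷ v) = legsMet-xPoints v

-- the complement of a set of x-points contains every y_i
legsMet-∁xPoints : ∀ {n} (v : Vec Bool n) → legsMet (∁ (xPoints v)) ≡ n
legsMet-∁xPoints []          = refl
legsMet-∁xPoints (true ∷ v)  = cong suc (legsMet-∁xPoints v)
legsMet-∁xPoints (false ∷ v) = cong suc (legsMet-∁xPoints v)

legsMet-thin : ∀ {n} (v : Vec Bool n) → legsMet (thin v) ≡ count v
legsMet-thin []          = refl
legsMet-thin (true ∷ v)  = cong suc (legsMet-xPoints v)
legsMet-thin (false ∷ v) = legsMet-thin v

-- the complement of 'thin v' meets every leg except the first chosen one
legsMet-∁thin : ∀ {n} (v : Vec Bool n) → 1 ≤ count v → suc (legsMet (∁ (thin v))) ≡ n
legsMet-∁thin (true ∷ v)  _        = cong suc (legsMet-∁xPoints v)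
legsMet-∁thin (false ∷ v) chosen≥1 = cong suc (legsMet-∁thin v chosen≥1)

xPoints-⊆-legs : ∀ {n} (v : Vec Bool n) → xPoints v ⊆ legs v
xPoints-⊆-legs []          = []
xPoints-⊆-legs (true ∷ v)  = refl ∷ xPoints-⊆-legs v
xPoints-⊆-legs (false ∷ v) = refl ∷ xPoints-⊆-legs v

thin-⊆-legs : ∀ {n} (v : Vec Bool n) → thin v ⊆ legs v
thin-⊆-legs []          = []
thin-⊆-legs (true ∷ v)  = refl ∷ xPoints-⊆-legs v
thin-⊆-legs (false ∷ v) = refl ∷ thin-⊆-legs v

Proper : ∀ {n} → SubE n → Set
Proper X = includesLeg X ≡ true × meetsAll X ≡ false

r-proper : ∀ {n} (X : SubE n) → Proper X → r n X ≡ suc (legsMet X)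
r-proper X (includes , misses) rewrite includes | misses = refl

λₙ-proper : ∀ {n} (X : SubE n) → Proper X → Proper (∁ X) →
  λₙ n X ≡ suc (legsMet X) + suc (legsMet (∁ X)) ∸ n
λₙ-proper {n} X p q = cong₂ (λ a b → a + b ∸ n) (r-proper X p) (r-proper (∁ X) q)

leg-not-transversal : ∀ {n} (X : SubE n) → includesLeg X ≡ true → ¬ IsTransversal X
leg-not-transversal ((true , true)  ∷ X) _        (() ∷ _)
leg-not-transversal ((true , false) ∷ X) includes (_ ∷ t) = leg-not-transversal X includes t
leg-not-transversal ((false , b)    ∷ X) includes (_ ∷ t) = leg-not-transversal X includes t

legs-proper : ∀ {n} (v : Vec Bool n) → 1 ≤ count v → 1 ≤ count (negate v) → Proper (legs v)
legs-proper v chosen≥1 unchosen≥1 = includes v chosen≥1 , misses v unchosen≥1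
  where
  includes : ∀ {n} (v : Vec Bool n) → 1 ≤ count v → includesLeg (legs v) ≡ true
  includes (true ∷ v)  _ = refl
  includes (false ∷ v) h = includes v h
  misses : ∀ {n} (v : Vec Bool n) → 1 ≤ count (negate v) → meetsAll (legs v) ≡ false
  misses (true ∷ v)  h = misses v h
  misses (false ∷ v) _ = refl

thin-proper : ∀ {n} (v : Vec Bool n) → 1 ≤ count v → 1 ≤ count (negate v) → Proper (thin v)
thin-proper v chosen≥1 unchosen≥1 = includes v chosen≥1 , misses v unchosen≥1
  where
  includes : ∀ {n} (v : Vec Bool n) → 1 ≤ count v → includesLeg (thin v) ≡ true
  includes (true ∷ v)  _ = refl
  includes (false ∷ v) h = includes v h
  xPoints-miss : ∀ {n} (v : Vec Bool n) → 1 ≤ count (negate v) → meetsAll (xPoints v) ≡ false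
  xPoints-miss (true ∷ v)  h = xPoints-miss v h
  xPoints-miss (false ∷ v) _ = refl
  misses : ∀ {n} (v : Vec Bool n) → 1 ≤ count (negate v) → meetsAll (thin v) ≡ false
  misses (true ∷ v)  h = xPoints-miss v h
  misses (false ∷ v) _ = refl

∁thin-proper : ∀ {n} (v : Vec Bool n) → 1 ≤ count v → 1 ≤ count (negate v) → Proper (∁ (thin v))
∁thin-proper v chosen≥1 unchosen≥1 = includes v unchosen≥1 , misses v chosen≥1
  where
  ∁xPoints-includes : ∀ {n} (v : Vec Bool n) → 1 ≤ count (negate v) →
    includesLeg (∁ (xPoints v)) ≡ true
  ∁xPoints-includes (true ∷ v)  h = ∁xPoints-includes v h
  ∁xPoints-includes (false ∷ v) _ = refl
  includes : ∀ {n} (v : Vec Bool n) → 1 ≤ count (negate v) → includesLeg (∁ (thin v)) ≡ true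
  includes (true ∷ v)  h = ∁xPoints-includes v h
  includes (false ∷ v) _ = refl
  misses : ∀ {n} (v : Vec Bool n) → 1 ≤ count v → meetsAll (∁ (thin v)) ≡ false
  misses (true ∷ v)  _ = refl
  misses (false ∷ v) h = misses v h

-- λ_n(legs v) = (k + 1) + (n - k + 1) - n = 2
λₙ-legs : ∀ {n} (v : Vec Bool n) → 1 ≤ count v → 1 ≤ count (negate v) → λₙ n (legs v) ≡ 2
λₙ-legs {n} v chosen≥1 unchosen≥1 = begin
  λₙ n (legs v)
    ≡⟨ λₙ-proper (legs v) (legs-proper v chosen≥1 unchosen≥1) ∁-proper ⟩
  suc (legsMet (legs v)) + suc (legsMet (∁ (legs v))) ∸ n
    ≡⟨ cong₂ (λ a b → suc a + suc b ∸ n) (legsMet-legs v)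
             (trans (cong legsMet (∁-legs v)) (legsMet-legs (negate v))) ⟩
  suc (count v) + suc (count (negate v)) ∸ n
    ≡⟨ cong (λ m → suc m ∸ n) (+-suc (count v) _) ⟩
  2 + (count v + count (negate v)) ∸ n
    ≡⟨ cong (λ m → 2 + m ∸ n) (count-negate v) ⟩
  2 + n ∸ n
    ≡⟨ m+n∸n≡m 2 n ⟩
  2 ∎
  where
  open ≡-Reasoning
  ∁-proper : Proper (∁ (legs v))
  ∁-proper = subst Proper (sym (∁-legs v))
    (legs-proper (negate v) unchosen≥1
      (subst (λ w → 1 ≤ count w) (sym (negate-involutive v)) chosen≥1))

-- λ_n(thin v) = (k + 1) + n - n = k + 1
λₙ-thin : ∀ {n} (v : Vec Bool n) → 1 ≤ count v → 1 ≤ count (negate v) →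
  λₙ n (thin v) ≡ suc (count v)
λₙ-thin {n} v chosen≥1 unchosen≥1 = begin
  λₙ n (thin v)
    ≡⟨ λₙ-proper (thin v) (thin-proper v chosen≥1 unchosen≥1)
                           (∁thin-proper v chosen≥1 unchosen≥1) ⟩
  suc (legsMet (thin v)) + suc (legsMet (∁ (thin v))) ∸ n
    ≡⟨ cong₂ (λ a b → suc a + b ∸ n) (legsMet-thin v) (legsMet-∁thin v chosen≥1) ⟩
  suc (count v) + n ∸ n
    ≡⟨ m+n∸n≡m (suc (count v)) n ⟩
  suc (count v) ∎
  where open ≡-Reasoning

⊆-full : ∀ {n} (X : SubE n) → X ⊆ full n
⊆-full []            = []
⊆-full ((a , b) ∷ X) = cong₂ _∧_ (∨-zeroʳ (not a)) (∨-zeroʳ (not b)) ∷ ⊆-full X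

∪-∁ : ∀ {n} (X : SubE n) → X ∪ ∁ X ≡ full n
∪-∁ []            = refl
∪-∁ ((a , b) ∷ X) = cong₂ _∷_ (cong₂ _,_ (∨-inverseʳ a) (∨-inverseʳ b)) (∪-∁ X)

card-∁ : ∀ {n} (X : SubE n) → ∣ X ∣ + ∣ ∁ X ∣ ≡ n + n
card-∁ []            = refl
card-∁ {suc n} ((a , b) ∷ X) = begin
  b2n a + b2n b + ∣ X ∣ + (b2n (not a) + b2n (not b) + ∣ ∁ X ∣)
    ≡⟨ leg-split a b ⟩
  2 + (∣ X ∣ + ∣ ∁ X ∣)
    ≡⟨ cong (2 +_) (card-∁ X) ⟩
  2 + (n + n)
    ≡⟨ cong suc (sym (+-suc n n)) ⟩
  suc n + suc n ∎
  where
  open ≡-Reasoning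
  leg-split : ∀ a b {x y} → b2n a + b2n b + x + (b2n (not a) + b2n (not b) + y) ≡ 2 + (x + y)
  leg-split true  true          = refl
  leg-split true  false {x} {y} = cong suc (+-suc x y)
  leg-split false true  {x} {y} = cong suc (+-suc x y)
  leg-split false false {x} {y} = trans (+-suc x (suc y)) (cong suc (+-suc x y))

module Connectivity {n} (M : Matroid n) where
  open Matroid M

  rank-≤-total : ∀ X → rank X ≤ rank (full n)
  rank-≤-total X = rank-mono X (full n) (⊆-full X)

  -- submodularity applied to X and E - X
  total-≤-sum : ∀ X → rank (full n) ≤ rank X + rank (∁ X)
  total-≤-sum X = ≤-trans (m≤m+n (rank (full n)) (rank (X ∩ ∁ X)))
    (subst (λ Y → rank Y + rank (X ∩ ∁ X) ≤ rank X + rank (∁ X)) (∪-∁ X) (rank-submod X (∁ X)))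

  -- the truncated subtraction in μ_M never truncates
  conn-+-total : ∀ X → conn M X + rank (full n) ≡ rank X + rank (∁ X)
  conn-+-total X = m∸n+n≡m (total-≤-sum X)

  conn-≤-rank : ∀ X → conn M X ≤ rank X
  conn-≤-rank X = ≤-trans (∸-monoˡ-≤ (rank (full n)) (+-monoʳ-≤ (rank X) (rank-≤-total (∁ X))))
                          (≤-reflexive (m+n∸n≡m (rank X) (rank (full n))))

  rank-sum-bound : ∀ X → rank X + rank (∁ X) ≤ n + n
  rank-sum-bound X = ≤-trans (+-mono-≤ (rank-bound X) (rank-bound (∁ X))) (≤-reflexive (card-∁ X))

module SpikeRanks {n} (M : Matroid n)
    (agree : ∀ X → includesLeg X ≡ true → conn M X ≡ λₙ n X) where
  open Matroid M
  open Connectivity M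

  conn-thin : ∀ v → 1 ≤ count v → 1 ≤ count (negate v) → conn M (thin v) ≡ suc (count v)
  conn-thin v chosen≥1 unchosen≥1 =
    trans (agree (thin v) (proj₁ (thin-proper v chosen≥1 unchosen≥1)))
          (λₙ-thin v chosen≥1 unchosen≥1)

  legs-lower : ∀ v → 1 ≤ count v → 1 ≤ count (negate v) → suc (count v) ≤ rank (legs v)
  legs-lower v chosen≥1 unchosen≥1 = begin
    suc (count v)  ≡⟨ conn-thin v chosen≥1 unchosen≥1 ⟨
    conn M (thin v) ≤⟨ conn-≤-rank (thin v) ⟩
    rank (thin v)  ≤⟨ rank-mono (thin v) (legs v) (thin-⊆-legs v) ⟩
    rank (legs v)  ∎
    where open ≤-Reasoning

  -- (2) r(E) = n, using a choice of all legs but one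
  total-rank : ∀ v → 1 ≤ count v → count (negate v) ≡ 1 → rank (full n) ≡ n
  total-rank v chosen≥1 one-unchosen = ≤-antisym total≤n n≤total
    where
    open ≤-Reasoning
    conn≡n : conn M (thin v) ≡ n
    conn≡n = begin-equality
      conn M (thin v)           ≡⟨ conn-thin v chosen≥1 (≤-reflexive (sym one-unchosen)) ⟩
      suc (count v)             ≡⟨ +-comm 1 (count v) ⟩
      count v + 1               ≡⟨ cong (count v +_) one-unchosen ⟨
      count v + count (negate v) ≡⟨ count-negate v ⟩
      n                         ∎
    n≤total : n ≤ rank (full n)
    n≤total = begin
      n               ≡⟨ conn≡n ⟨
      conn M (thin v) ≤⟨ conn-≤-rank (thin v) ⟩
      rank (thin v)   ≤⟨ rank-≤-total (thin v) ⟩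
      rank (full n)   ∎
    total≤n : rank (full n) ≤ n
    total≤n = +-cancelˡ-≤ n (rank (full n)) n (begin
      n + rank (full n)                ≡⟨ cong (_+ rank (full n)) conn≡n ⟨
      conn M (thin v) + rank (full n)  ≡⟨ conn-+-total (thin v) ⟩
      rank (thin v) + rank (∁ (thin v)) ≤⟨ rank-sum-bound (thin v) ⟩
      n + n                            ∎)

  legs-rank : rank (full n) ≡ n → ∀ v → 1 ≤ count v → 1 ≤ count (negate v) →
    rank (legs v) ≡ suc (count v)
  legs-rank total v chosen≥1 unchosen≥1 =
    ≤-antisym upper (legs-lower v chosen≥1 unchosen≥1)
    where
    open ≤-Reasoning
    k  = count v
    k′ = count (negate v)
    complement-lower : suc k′ ≤ rank (∁ (legs v))
    complement-lower = subst (λ Y → suc k′ ≤ rank Y) (sym (∁-legs v))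
      (legs-lower (negate v) unchosen≥1
        (subst (λ w → 1 ≤ count w) (sym (negate-involutive v)) chosen≥1))
    upper : rank (legs v) ≤ suc k
    upper = +-cancelʳ-≤ (suc k′) (rank (legs v)) (suc k) (begin
      rank (legs v) + suc k′            ≤⟨ +-monoʳ-≤ (rank (legs v)) complement-lower ⟩
      rank (legs v) + rank (∁ (legs v)) ≡⟨ conn-+-total (legs v) ⟨
      conn M (legs v) + rank (full n)   ≡⟨ cong₂ _+_ (trans (agree (legs v) includes)
                                                       (λₙ-legs v chosen≥1 unchosen≥1)) total ⟩
      2 + n                             ≡⟨ cong (2 +_) (count-negate v) ⟨
      2 + (k + k′)                      ≡⟨ cong suc (+-suc k k′) ⟨
      suc k + suc k′                    ∎)
      where
      includes : includesLeg (legs v) ≡ true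
      includes = proj₁ (legs-proper v chosen≥1 unchosen≥1)

lemma5 : (n : ℕ) → 3 ≤ n → (λf : SubE n → ℕ) → Spiky n λf →
    (M : Matroid n) → (∀ X → λf X ≡ conn M X) → IsSpike M
lemma5 (suc zero) (s≤s ()) _ _ _ _
lemma5 (suc (suc k)) _ λf spiky M λf≡conn = leg-unions , total
  where
  n = suc (suc k)
  open Matroid M

  agree : ∀ X → includesLeg X ≡ true → conn M X ≡ λₙ n X
  agree X includes = trans (sym (λf≡conn X))
                           (Spiky.offT spiky X (leg-not-transversal X includes))
  open SpikeRanks M agree

  all-chosen : ∀ j → count (negate (replicate j true)) ≡ 0
  all-chosen zero    = refl
  all-chosen (suc j) = all-chosen j

  total : rank (full n) ≡ n
  total = total-rank (false ∷ replicate (suc k) true) (s≤s z≤n) (cong suc (all-chosen (suc k)))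

  leg-unions : ∀ X → IsLegUnion X → 1 ≤ legsMet X → legsMet X ≤ n ∸ 1 →
    rank X ≡ suc (legsMet X)
  leg-unions X union met≥1 met≤ =
    subst (λ Y → rank Y ≡ suc (legsMet Y)) (sym X≡legs)
      (trans (legs-rank total v chosen≥1 (complement-nonempty v chosen≥1 chosen≤))
             (cong suc (sym (legsMet-legs v))))
    where
    v = map proj₁ X
    X≡legs = legs-of-union X union
    met≡count : legsMet X ≡ count v
    met≡count = trans (cong legsMet X≡legs) (legsMet-legs v)
    chosen≥1 = subst (1 ≤_) met≡count met≥1
    chosen≤  = subst (_≤ n ∸ 1) met≡count met≤
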